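{- Let $G$ be a graph and assume there is a double total dominating set $T\subsetneq V(G)$. Then $\chi_d(G)\leq 2\chi(G)$.
   Context: All graphs are finite and simple. A set $T\subseteq V(G)$ is a total dominating set if every vertex of $G$ has at least one neighbor in $T$; $T$ is a double total dominating set if both $T$ and $V(G)\setminus T$ are total dominating sets. A dynamic coloring of $G$ is a proper vertex coloring such that every vertex of degree at least $2$ has neighbors of at least two different colors; $\chi_d(G)$ is the smallest number of colors in a dynamic coloring, and $\chi(G)$ is the chromatic number. -}

module Defs where

open import Data.Nat using (ℕ; _≤_; _+_; _*_)
open import Data.Fin using (Fin)
open import Data.Bool using (Bool; true; false; if_then_else_)
open import Data.List using (List; map; allFin)
open import Data.Nat.ListAction using (sum)
open import Data.Product using (Σ; _×_; ∃-syntax)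
open import Relation.Binary.PropositionalEquality using (_≡_; _≢_)

record Graph : Set where
  field
    n        : ℕ
    adj      : Fin n → Fin n → Bool
    sym      : ∀ u v → adj u v ≡ adj v u
    irrefl   : ∀ v → adj v v ≡ false

open Graph public

VSet : Graph → Set
VSet G = Fin (n G) → Bool

compl : (G : Graph) → VSet G → VSet G
compl G T v = if T v then false else true

ProperSubset : (G : Graph) → VSet G → Set
ProperSubset G T = ∃[ v ] T v ≡ false

TotalDominating : (G : Graph) → VSet G → Set
TotalDominating G T = ∀ v → ∃[ u ] (adj G v u ≡ true × T u ≡ true)

DoubleTotalDominating : (G : Graph) → VSet G → Set
DoubleTotalDominating G T = TotalDominating G T × TotalDominating G (compl G T)

degree : (G : Graph) → Fin (n G) → ℕ
degree G v = sum (map (λ u → if adj G v u then 1 else 0) (allFin (n G)))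

IsProperColoring : (G : Graph) (k : ℕ) → (Fin (n G) → Fin k) → Set
IsProperColoring G k c = ∀ u v → adj G u v ≡ true → c u ≢ c v

IsDynamicColoring : (G : Graph) (k : ℕ) → (Fin (n G) → Fin k) → Set
IsDynamicColoring G k c =
  IsProperColoring G k c ×
  (∀ v → 2 ≤ degree G v →
     ∃[ u ] ∃[ w ] (adj G v u ≡ true × adj G v w ≡ true × c u ≢ c w))

Colorable : Graph → ℕ → Set
Colorable G k = Σ (Fin (n G) → Fin k) (IsProperColoring G k)

DynColorable : Graph → ℕ → Set
DynColorable G k = Σ (Fin (n G) → Fin k) (IsDynamicColoring G k)

IsChromaticNumber : Graph → ℕ → Set
IsChromaticNumber G k = Colorable G k × (∀ m → Colorable G m → k ≤ m)

IsDynamicChromaticNumber : Graph → ℕ → Set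
IsDynamicChromaticNumber G k = DynColorable G k × (∀ m → DynColorable G m → k ≤ m)

-- Refine a proper k-colouring c by the side of T a vertex lies on: colour v
-- with the pair (v ∈ T, c v).  This is still proper, and since T and its
-- complement are both total dominating, every vertex sees a neighbour in T and
-- one outside T, which carry different colours.
module Submission where

open import Defs
open import Data.Nat using (ℕ; _≤_; _*_)
open import Data.Bool using (Bool; true; false)
open import Data.Fin using (Fin; combine)
open import Data.Fin.Properties using (2↔Bool; combine-injectiveˡ; combine-injectiveʳ)
open import Data.Product using (∃-syntax; _×_; _,_)
open import Function.Bundles using (_↣_; Injection)
open import Function.Properties.Inverse using (↔-sym; ↔⇒↣)
open import Relation.Binary.PropositionalEquality as ≡ using (_≡_; _≢_; refl; subst₂)

private
  variable
    k : ℕ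

compl-true⇒false : (G : Graph) (T : VSet G) (v : Fin (n G)) → compl G T v ≡ true → T v ≡ false
compl-true⇒false G T v eq with T v
compl-true⇒false G T v () | true
compl-true⇒false G T v eq | false = refl

doubleTotalDominating⇒neighbours-in-and-out :
  (G : Graph) (T : VSet G) → DoubleTotalDominating G T → ∀ v →
  ∃[ u ] ∃[ w ] (adj G v u ≡ true × adj G v w ≡ true × T u ≡ true × T w ≡ false)
doubleTotalDominating⇒neighbours-in-and-out G T (domT , domCompl) v
  with domT v | domCompl v
... | u , vu , Tu | w , vw , ¬Tw = u , w , vu , vw , Tu , compl-true⇒false G T w ¬Tw

Bool↣Fin2 : Bool ↣ Fin 2
Bool↣Fin2 = ↔⇒↣ (↔-sym 2↔Bool)

open Injection Bool↣Fin2 using () renaming (to to toFin; injective to toFin-injective)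

splitColoring : (G : Graph) (T : VSet G) → (Fin (n G) → Fin k) → Fin (n G) → Fin (2 * k)
splitColoring G T c v = combine (toFin (T v)) (c v)

splitColoring-proper : (G : Graph) (T : VSet G) (c : Fin (n G) → Fin k) →
  IsProperColoring G k c → IsProperColoring G (2 * k) (splitColoring G T c)
splitColoring-proper G T c proper u v uv eq =
  proper u v uv (combine-injectiveʳ (toFin (T u)) (c u) (toFin (T v)) (c v) eq)

splitColoring-separates : (G : Graph) (T : VSet G) (c : Fin (n G) → Fin k) {u w : Fin (n G)} →
  T u ≢ T w → splitColoring G T c u ≢ splitColoring G T c w
splitColoring-separates G T c {u} {w} Tu≢Tw eq =
  Tu≢Tw (toFin-injective (combine-injectiveˡ (toFin (T u)) (c u) (toFin (T w)) (c w) eq))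

-- Even vertices of degree < 2 get two differently coloured neighbours.
splitColoring-dynamic : (G : Graph) (T : VSet G) (c : Fin (n G) → Fin k) →
  DoubleTotalDominating G T → IsProperColoring G k c →
  IsDynamicColoring G (2 * k) (splitColoring G T c)
splitColoring-dynamic G T c dtd proper = splitColoring-proper G T c proper , separated
  where
  separated : ∀ v → 2 ≤ degree G v → ∃[ u ] ∃[ w ]
    (adj G v u ≡ true × adj G v w ≡ true × splitColoring G T c u ≢ splitColoring G T c w)
  separated v _ with doubleTotalDominating⇒neighbours-in-and-out G T dtd v
  ... | u , w , vu , vw , Tu , Tw =
    u , w , vu , vw , splitColoring-separates G T c (subst₂ _≢_ (≡.sym Tu) (≡.sym Tw) λ ())

doubleTotalDominating⇒dynColorable : (G : Graph) (T : VSet G) → DoubleTotalDominating G T →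
  Colorable G k → DynColorable G (2 * k)
doubleTotalDominating⇒dynColorable G T dtd (c , proper) =
  splitColoring G T c , splitColoring-dynamic G T c dtd proper

corollary2 : (G : Graph) →
    (∃[ T ] (DoubleTotalDominating G T × ProperSubset G T)) →
    (χ χd : ℕ) → IsChromaticNumber G χ → IsDynamicChromaticNumber G χd →
    χd ≤ 2 * χ
corollary2 G (T , dtd , _) χ χd (colorable , _) (_ , χd-least) =
  χd-least (2 * χ) (doubleTotalDominating⇒dynColorable G T dtd colorable)
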